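{- Let $evs\in\mathit{nsl}$, let $A,B$ be agents with $A\notin\mathit{bad}$ and $B\notin\mathit{bad}$, and suppose $\mathit{Says}\ A\ B\ (\mathit{Crypt}\ (\mathit{pubK}\ B)\ \langle\mathit{Nonce}\ NA,\mathit{Agent}\ A\rangle)\in\mathit{set}\ evs$. Then every message of $\mathit{spies}\ evs$ belongs to $\mathit{guard}\ NA\ \{\mathit{priK}\ A,\mathit{priK}\ B\}$.
   Context: Messages: free datatype msg ::= Number nat | Nonce nat | Agent agent | Key key | Hash msg | ⟨msg,msg⟩ | Crypt key msg; ⟨X,Y,Z⟩ abbreviates ⟨X,⟨Y,Z⟩⟩. Each agent $A$ has a public key $\mathit{pubK}\ A$ and private key $\mathit{priK}\ A$, inverse to each other under $\mathit{invKey}$. $\mathit{parts}$, $\mathit{analz}$, $\mathit{synth}$ are the usual Paulson closure operators: $\mathit{parts}\ H$ closes $H$ under pair components and encryption bodies; $\mathit{analz}\ H$ closes $H$ under pair components and decryption of $\mathit{Crypt}\ K\ X$ when $\mathit{Key}(\mathit{invKey}\ K)$ is already in it; $\mathit{synth}\ H$ closes $H$ under adding agent names, numbers, hashing, pairing and encryption with keys $\mathit{Key}\ K\in H$. $\mathit{bad}$ is the set of compromised agents (Spy $\in\mathit{bad}$). Events are $\mathit{Says}\ A\ B\ X$; $\mathit{set}\ evs$ is the set of events of trace $evs$; $\mathit{spies}\ evs$ is the spy's knowledge: its initial knowledge (all public keys, the private keys of bad agents) plus every message sent in $evs$; $\mathit{used}\ evs$ is the parts of all messages sent (and of initial knowledge).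 $\mathit{nsl}$ is the least set of traces with: $[]\in\mathit{nsl}$; (Fake) $evs\in\mathit{nsl}$, $X\in\mathit{synth}(\mathit{analz}(\mathit{spies}\ evs))\Rightarrow \mathit{Says}\ \mathit{Spy}\ B\ X\#evs\in\mathit{nsl}$; (NS1) $evs\in\mathit{nsl}$, $\mathit{Nonce}\ NA\notin\mathit{used}\ evs\Rightarrow \mathit{Says}\ A\ B\ (\mathit{Crypt}(\mathit{pubK}\ B)\langle\mathit{Nonce}\ NA,\mathit{Agent}\ A\rangle)\#evs\in\mathit{nsl}$; (NS2) $evs\in\mathit{nsl}$, $\mathit{Nonce}\ NB\notin\mathit{used}\ evs$, $\mathit{Says}\ A'\ B\ (\mathit{Crypt}(\mathit{pubK}\ B)\langle\mathit{Nonce}\ NA,\mathit{Agent}\ A\rangle)\in\mathit{set}\ evs\Rightarrow \mathit{Says}\ B\ A\ (\mathit{Crypt}(\mathit{pubK}\ A)\langle\mathit{Nonce}\ NA,\mathit{Nonce}\ NB,\mathit{Agent}\ B\rangle)\#evs\in\mathit{nsl}$; (NS3) $evs\in\mathit{nsl}$, $\mathit{Says}\ A\ B\ (\mathit{Crypt}(\mathit{pubK}\ B)\langle\mathit{Nonce}\ NA,\mathit{Agent}\ A\rangle)\in\mathit{set}\ evs$, $\mathit{Says}\ B'\ A\ (\mathit{Crypt}(\mathit{pubK}\ A)\langle\mathit{Nonce}\ NA,\mathit{Nonce}\ NB,\mathit{Agent}\ B\rangle)\in\mathit{set}\ evs\Rightarrow\mathit{Says}\ A\ B\ (\mathit{Crypt}(\mathit{pubK}\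 B)(\mathit{Nonce}\ NB))\#evs\in\mathit{nsl}$. $\mathit{guard}\ n\ Ks$ is the least set of messages containing: every $X$ with $\mathit{Nonce}\ n\notin\mathit{parts}\{X\}$; every $\mathit{Crypt}\ K\ X$ with $\mathit{invKey}\ K\in Ks$; $\mathit{Crypt}\ K\ X$ whenever $X\in\mathit{guard}\ n\ Ks$; $\langle X,Y\rangle$ whenever $X,Y\in\mathit{guard}\ n\ Ks$. -}

module Defs where

open import Data.Nat using (ℕ)
open import Data.List using (List; []; _∷_)
open import Data.List.Membership.Propositional using (_∈_)
open import Data.Product using (∃; ∃₂; _×_)
open import Data.Sum using (_⊎_)
open import Relation.Binary.PropositionalEquality using (_≡_)
open import Relation.Nullary using (¬_)

data agent : Set where
  Server : agent
  Friend : ℕ → agent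
  Spy    : agent

data key : Set where
  pubK : agent → key
  priK : agent → key

invKey : key → key
invKey (pubK A) = priK A
invKey (priK A) = pubK A

infixr 4 ⟨_,_⟩
data msg : Set where
  Number : ℕ → msg
  Nonce  : ℕ → msg
  Agent  : agent → msg
  Key    : key → msg
  Hash   : msg → msg
  ⟨_,_⟩  : msg → msg → msg
  Crypt  : key → msg → msg

MsgSet : Set₁
MsgSet = msg → Set

data parts (H : MsgSet) : MsgSet where
  inj  : ∀ {X} → H X → parts H X
  fst  : ∀ {X Y} → parts H ⟨ X , Y ⟩ → parts H X
  snd  : ∀ {X Y} → parts H ⟨ X , Y ⟩ → parts H Y
  body : ∀ {K X} → parts H (Crypt K X) → parts H X

data analz (H : MsgSet) : MsgSet where
  inj     : ∀ {X} → H X → analz H X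
  fst     : ∀ {X Y} → analz H ⟨ X , Y ⟩ → analz H X
  snd     : ∀ {X Y} → analz H ⟨ X , Y ⟩ → analz H Y
  decrypt : ∀ {K X} → analz H (Crypt K X) → analz H (Key (invKey K)) → analz H X

data synth (H : MsgSet) : MsgSet where
  inj    : ∀ {X} → H X → synth H X
  agent' : ∀ A → synth H (Agent A)
  number : ∀ n → synth H (Number n)
  hash   : ∀ {X} → synth H X → synth H (Hash X)
  pair   : ∀ {X Y} → synth H X → synth H Y → synth H ⟨ X , Y ⟩
  crypt  : ∀ {K X} → H (Key K) → synth H X → synth H (Crypt K X)

-- Events and traces (most recent event first)
data event : Set where
  Says : agent → agent → msg → event

trace : Set
trace = List event

data spies (bad : agent → Set) (evs : trace) : MsgSet where
  pubKey  : ∀ A → spies bad evs (Key (pubK A))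
  badPriK : ∀ {A} → bad A → spies bad evs (Key (priK A))
  said    : ∀ {A B X} → Says A B X ∈ evs → spies bad evs X

-- initial knowledge of all agents (union of all initState's): all keys
-- together with every message sent
data sentOrInit (evs : trace) : MsgSet where
  initKey : ∀ K → sentOrInit evs (Key K)
  said    : ∀ {A B X} → Says A B X ∈ evs → sentOrInit evs X

used : trace → MsgSet
used evs = parts (sentOrInit evs)

data nsl (bad : agent → Set) : trace → Set where
  Nil  : nsl bad []
  Fake : ∀ {evs B X} → nsl bad evs →
         synth (analz (spies bad evs)) X →
         nsl bad (Says Spy B X ∷ evs)
  NS1  : ∀ {evs A B NA} → nsl bad evs →
         ¬ used evs (Nonce NA) →
         nsl bad (Says A B (Crypt (pubK B) ⟨ Nonce NA , Agent A ⟩) ∷ evs)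
  NS2  : ∀ {evs A A' B NA NB} → nsl bad evs →
         ¬ used evs (Nonce NB) →
         Says A' B (Crypt (pubK B) ⟨ Nonce NA , Agent A ⟩) ∈ evs →
         nsl bad (Says B A (Crypt (pubK A) ⟨ Nonce NA , ⟨ Nonce NB , Agent B ⟩ ⟩) ∷ evs)
  NS3  : ∀ {evs A B B' NA NB} → nsl bad evs →
         Says A B (Crypt (pubK B) ⟨ Nonce NA , Agent A ⟩) ∈ evs →
         Says B' A (Crypt (pubK A) ⟨ Nonce NA , ⟨ Nonce NB , Agent B ⟩ ⟩) ∈ evs →
         nsl bad (Says A B (Crypt (pubK B) (Nonce NB)) ∷ evs)

singleton : msg → MsgSet
singleton X Y = Y ≡ X

data guard (n : ℕ) (Ks : key → Set) : MsgSet where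
  noNonce : ∀ {X} → ¬ parts (singleton X) (Nonce n) → guard n Ks X
  keyed   : ∀ {K X} → Ks (invKey K) → guard n Ks (Crypt K X)
  crypt   : ∀ {K X} → guard n Ks X → guard n Ks (Crypt K X)
  pair    : ∀ {X Y} → guard n Ks X → guard n Ks Y → guard n Ks ⟨ X , Y ⟩

{-# OPTIONS --safe #-}
-- Private keys of honest agents never become known to the spy, since no
-- protocol step sends a key and the spy can only forward keys it already
-- has. Given that, one proves by induction on the trace a strengthening of
-- the guard property: every occurrence of NA in a spied message lies inside
-- A's first message to B, or inside a reply of B to A carrying NA as the
-- first nonce and a second nonce different from NA. This invariant is closed
-- under analz and synth (decrypting either message needs priK A or priK B),
-- and it is what rules out the two dangerous protocol steps: a reply that
-- echoes NA can only answer A's own message, and NA is never returned as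
-- the second nonce of a reply, so it is never sent in a third message.
module Submission where

open import Defs
open import Data.Nat using (ℕ)
open import Data.Nat.Properties using (_≟_)
open import Data.Sum using (_⊎_; inj₁; inj₂)
open import Data.Product using (∃-syntax; _×_; _,_)
open import Data.Empty using (⊥-elim)
open import Data.List.Relation.Unary.Any using (here; there)
open import Data.List.Membership.Propositional using (_∈_)
open import Relation.Binary.PropositionalEquality using (_≡_; refl)
open import Relation.Nullary using (¬_; yes; no)

infix 4 _⊑_

data _⊑_ (Y : msg) : msg → Set where
  self : Y ⊑ Y
  fst  : ∀ {X X′} → Y ⊑ X → Y ⊑ ⟨ X , X′ ⟩
  snd  : ∀ {X X′} → Y ⊑ X′ → Y ⊑ ⟨ X , X′ ⟩
  body : ∀ {K X} → Y ⊑ X → Y ⊑ Crypt K X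

⊑-trans : ∀ {X Y Z} → Z ⊑ Y → Y ⊑ X → Z ⊑ X
⊑-trans z⊑y self     = z⊑y
⊑-trans z⊑y (fst p)  = fst (⊑-trans z⊑y p)
⊑-trans z⊑y (snd p)  = snd (⊑-trans z⊑y p)
⊑-trans z⊑y (body p) = body (⊑-trans z⊑y p)

parts-singleton⇒⊑ : ∀ {X Y} → parts (singleton X) Y → Y ⊑ X
parts-singleton⇒⊑ (inj refl) = self
parts-singleton⇒⊑ (fst p)    = ⊑-trans (fst self) (parts-singleton⇒⊑ p)
parts-singleton⇒⊑ (snd p)    = ⊑-trans (snd self) (parts-singleton⇒⊑ p)
parts-singleton⇒⊑ (body p)   = ⊑-trans (body self) (parts-singleton⇒⊑ p)

parts-⊑ : ∀ {H X Y} → Y ⊑ X → parts H X → parts H Y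
parts-⊑ self     p = p
parts-⊑ (fst s)  p = parts-⊑ s (fst p)
parts-⊑ (snd s)  p = parts-⊑ s (snd p)
parts-⊑ (body s) p = parts-⊑ s (body p)

analz-⊑ : ∀ {G Y Z} → analz G Y → Z ⊑ Y → ∃[ W ] G W × Z ⊑ W
analz-⊑ (inj g)       s = _ , g , s
analz-⊑ (fst p)       s = analz-⊑ p (fst s)
analz-⊑ (snd p)       s = analz-⊑ p (snd s)
analz-⊑ (decrypt p _) s = analz-⊑ p (body s)

synth-analz-Key-⊑ : ∀ {G K X} → synth (analz G) X → Key K ⊑ X →
                    ∃[ W ] G W × Key K ⊑ W
synth-analz-Key-⊑ (inj a)     s        = analz-⊑ a s
synth-analz-Key-⊑ (pair x _)  (fst s)  = synth-analz-Key-⊑ x s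
synth-analz-Key-⊑ (pair _ y)  (snd s)  = synth-analz-Key-⊑ y s
synth-analz-Key-⊑ (crypt _ x) (body s) = synth-analz-Key-⊑ x s

used-⊑ : ∀ {evs A B M Y} → Says A B M ∈ evs → Y ⊑ M → used evs Y
used-⊑ m s = parts-⊑ s (inj (said m))

priK-⊑-spies⇒bad : ∀ {bad evs C X} → nsl bad evs → spies bad evs X →
                   Key (priK C) ⊑ X → bad C
priK-⊑-spies⇒bad _ (badPriK b) self = b
priK-⊑-spies⇒bad (Fake t x) (said (here refl)) s with synth-analz-Key-⊑ x s
... | _ , w , s′ = priK-⊑-spies⇒bad t w s′
priK-⊑-spies⇒bad (NS1 _ _)   (said (here refl)) (body (fst ()))
priK-⊑-spies⇒bad (NS1 _ _)   (said (here refl)) (body (snd ()))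
priK-⊑-spies⇒bad (NS2 _ _ _) (said (here refl)) (body (fst ()))
priK-⊑-spies⇒bad (NS2 _ _ _) (said (here refl)) (body (snd (fst ())))
priK-⊑-spies⇒bad (NS2 _ _ _) (said (here refl)) (body (snd (snd ())))
priK-⊑-spies⇒bad (NS3 _ _ _) (said (here refl)) (body ())
priK-⊑-spies⇒bad (Fake t _)  (said (there m)) s = priK-⊑-spies⇒bad t (said m) s
priK-⊑-spies⇒bad (NS1 t _)   (said (there m)) s = priK-⊑-spies⇒bad t (said m) s
priK-⊑-spies⇒bad (NS2 t _ _) (said (there m)) s = priK-⊑-spies⇒bad t (said m) s
priK-⊑-spies⇒bad (NS3 t _ _) (said (there m)) s = priK-⊑-spies⇒bad t (said m) s

priK-analz⇒bad : ∀ {bad evs C} → nsl bad evs →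
                 analz (spies bad evs) (Key (priK C)) → bad C
priK-analz⇒bad t k with analz-⊑ k self
... | _ , x , s = priK-⊑-spies⇒bad t x s

data StrongGuard (NA : ℕ) (A B : agent) : msg → Set where
  noNonce : ∀ {X} → ¬ Nonce NA ⊑ X → StrongGuard NA A B X
  ns1     : StrongGuard NA A B (Crypt (pubK B) ⟨ Nonce NA , Agent A ⟩)
  ns2     : ∀ {NB} → ¬ NB ≡ NA →
            StrongGuard NA A B (Crypt (pubK A) ⟨ Nonce NA , ⟨ Nonce NB , Agent B ⟩ ⟩)
  pair    : ∀ {X Y} → StrongGuard NA A B X → StrongGuard NA A B Y →
            StrongGuard NA A B ⟨ X , Y ⟩
  crypt   : ∀ {K X} → StrongGuard NA A B X → StrongGuard NA A B (Crypt K X)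

module _ {NA : ℕ} {A B : agent} where

  StrongGuard⇒guard : ∀ {X} → StrongGuard NA A B X →
    guard NA (λ K → K ≡ priK A ⊎ K ≡ priK B) X
  StrongGuard⇒guard (noNonce f) = noNonce (λ p → f (parts-singleton⇒⊑ p))
  StrongGuard⇒guard ns1         = keyed (inj₂ refl)
  StrongGuard⇒guard (ns2 _)     = keyed (inj₁ refl)
  StrongGuard⇒guard (pair x y)  = pair (StrongGuard⇒guard x) (StrongGuard⇒guard y)
  StrongGuard⇒guard (crypt x)   = crypt (StrongGuard⇒guard x)

  ¬StrongGuard-Nonce : ¬ StrongGuard NA A B (Nonce NA)
  ¬StrongGuard-Nonce (noNonce f) = f self

  StrongGuard-fst : ∀ {X Y} → StrongGuard NA A B ⟨ X , Y ⟩ → StrongGuard NA A B X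
  StrongGuard-fst (noNonce f) = noNonce (λ s → f (fst s))
  StrongGuard-fst (pair x _)  = x

  StrongGuard-snd : ∀ {X Y} → StrongGuard NA A B ⟨ X , Y ⟩ → StrongGuard NA A B Y
  StrongGuard-snd (noNonce f) = noNonce (λ s → f (snd s))
  StrongGuard-snd (pair _ y)  = y

  module _ {G : MsgSet} (G-guarded : ∀ {X} → G X → StrongGuard NA A B X)
           (priK-A-secret : ¬ analz G (Key (priK A)))
           (priK-B-secret : ¬ analz G (Key (priK B))) where

    analz-StrongGuard : ∀ {X} → analz G X → StrongGuard NA A B X
    analz-StrongGuard (inj g)       = G-guarded g
    analz-StrongGuard (fst p)       = StrongGuard-fst (analz-StrongGuard p)
    analz-StrongGuard (snd p)       = StrongGuard-snd (analz-StrongGuard p)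
    analz-StrongGuard (decrypt p k) = decrypt-StrongGuard (analz-StrongGuard p) k
      where
      decrypt-StrongGuard : ∀ {K X} → StrongGuard NA A B (Crypt K X) →
                            analz G (Key (invKey K)) → StrongGuard NA A B X
      decrypt-StrongGuard (noNonce f) _ = noNonce (λ s → f (body s))
      decrypt-StrongGuard ns1         k = ⊥-elim (priK-B-secret k)
      decrypt-StrongGuard (ns2 _)     k = ⊥-elim (priK-A-secret k)
      decrypt-StrongGuard (crypt x)   _ = x

    synth-analz-StrongGuard : ∀ {X} → synth (analz G) X → StrongGuard NA A B X
    synth-analz-StrongGuard (inj a)     = analz-StrongGuard a
    synth-analz-StrongGuard (agent' _)  = noNonce (λ ())
    synth-analz-StrongGuard (number _)  = noNonce (λ ())
    synth-analz-StrongGuard (hash _)    = noNonce (λ ())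
    synth-analz-StrongGuard (pair x y)  =
      pair (synth-analz-StrongGuard x) (synth-analz-StrongGuard y)
    synth-analz-StrongGuard (crypt _ x) = crypt (synth-analz-StrongGuard x)

  StrongGuard-NS1⇒intended : ∀ {A′ B′} →
    StrongGuard NA A B (Crypt (pubK B′) ⟨ Nonce NA , Agent A′ ⟩) → B′ ≡ B × A′ ≡ A
  StrongGuard-NS1⇒intended (noNonce f) = ⊥-elim (f (body (fst self)))
  StrongGuard-NS1⇒intended ns1         = refl , refl
  StrongGuard-NS1⇒intended (crypt x)   = ⊥-elim (¬StrongGuard-Nonce (StrongGuard-fst x))

  ¬StrongGuard-NS2-echo : ∀ {K N C} →
    ¬ StrongGuard NA A B (Crypt K ⟨ Nonce N , ⟨ Nonce NA , Agent C ⟩ ⟩)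
  ¬StrongGuard-NS2-echo (noNonce f) = f (body (snd (fst self)))
  ¬StrongGuard-NS2-echo (ns2 NA≢NA) = NA≢NA refl
  ¬StrongGuard-NS2-echo (crypt x)   = ¬StrongGuard-Nonce (StrongGuard-fst (StrongGuard-snd x))

module _ {bad : agent → Set} (Spy-bad : bad Spy) {A B : agent} {NA : ℕ}
         (A-good : ¬ bad A) (B-good : ¬ bad B) where

  spies⇒StrongGuard : ∀ {evs X} → nsl bad evs →
    Says A B (Crypt (pubK B) ⟨ Nonce NA , Agent A ⟩) ∈ evs →
    spies bad evs X → StrongGuard NA A B X
  spies⇒StrongGuard _ _ (pubKey _)  = noNonce (λ ())
  spies⇒StrongGuard _ _ (badPriK _) = noNonce (λ ())
  spies⇒StrongGuard (Fake _ _) (here refl) _ = ⊥-elim (A-good Spy-bad)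
  spies⇒StrongGuard (Fake t x) (there h) (said (here refl)) =
    synth-analz-StrongGuard (spies⇒StrongGuard t h)
      (λ k → A-good (priK-analz⇒bad t k)) (λ k → B-good (priK-analz⇒bad t k)) x
  spies⇒StrongGuard (NS1 _ _)     (here refl) (said (here refl)) = ns1
  spies⇒StrongGuard (NS1 _ fresh) (here refl) (said (there m))   =
    noNonce (λ s → fresh (used-⊑ m s))
  spies⇒StrongGuard (NS1 _ fresh) (there h) (said (here refl)) =
    noNonce λ { (body (fst self)) → fresh (used-⊑ h (body (fst self))) ; (body (snd ())) }
  spies⇒StrongGuard (NS2 {NA = N} t fresh q) (there h) (said (here refl)) with N ≟ NA
  ... | no N≢NA = noNonce λ { (body (fst self))       → N≢NA refl
                            ; (body (snd (fst self))) → fresh (used-⊑ h (body (fst self)))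
                            ; (body (snd (snd ()))) }
  ... | yes refl with StrongGuard-NS1⇒intended (spies⇒StrongGuard t h (said q))
  ...   | refl , refl = ns2 λ { refl → fresh (used-⊑ h (body (fst self))) }
  spies⇒StrongGuard (NS3 t _ q) (there h) (said (here refl)) =
    noNonce λ { (body self) → ¬StrongGuard-NS2-echo (spies⇒StrongGuard t h (said q)) }
  spies⇒StrongGuard (Fake t _)  (there h) (said (there m)) = spies⇒StrongGuard t h (said m)
  spies⇒StrongGuard (NS1 t _)   (there h) (said (there m)) = spies⇒StrongGuard t h (said m)
  spies⇒StrongGuard (NS2 t _ _) (there h) (said (there m)) = spies⇒StrongGuard t h (said m)
  spies⇒StrongGuard (NS3 t _ _) (there h) (said (there m)) = spies⇒StrongGuard t h (said m)

mainTheorem4 : (bad : agent → Set) → bad Spy →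
    ∀ (evs : trace) → nsl bad evs →
    ∀ (A B : agent) (NA : ℕ) → ¬ bad A → ¬ bad B →
    Says A B (Crypt (pubK B) ⟨ Nonce NA , Agent A ⟩) ∈ evs →
    ∀ (X : msg) → spies bad evs X →
    guard NA (λ K → K ≡ priK A ⊎ K ≡ priK B) X
mainTheorem4 bad Spy-bad evs t A B NA A-good B-good h X x =
  StrongGuard⇒guard (spies⇒StrongGuard Spy-bad A-good B-good t h x)
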